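{- Fix an integer $r\geq 3$, a sufficiently large integer $n$, and $A\subseteq[n]$ with $|A|=(1-\xi)n$, where $0\leq\xi\leq r^{ -3}$. Let $\delta=1/(24\log_2 n)$. For two distinct colors $i,j\in[r]$, let $\mathcal{P}=\mathcal{P}(i,j)$ be the set of good $r$-templates of $A$ in which at least $(1-2\delta)n$ elements $x\in A$ have palette $P(x)=\{i,j\}$. Then $$g(\mathcal{P},A)\leq 2^{|A|}(1+2^{ -n/12}).$$
   Context: An $r$-template of order $n$ is a function $P:[n]\to 2^{[r]}$ (palette $P(x)\subseteq[r]$). A restricted Schur triple in $[n]$ is an ordered triple $(a,b,c)$ with $a<b<c$, $a+b=c$; $s([n])$ is their number. $RS(P)$ is the number of restricted Schur triples $(a,b,c)$ together with pairwise distinct colors $\alpha\in P(a),\beta\in P(b),\gamma\in P(c)$. A good $r$-template of $A$ is an $r$-template $P$ of order $n$ with $|P(x)|\geq1$ for all $x\in A$ and $RS(P)\leq n^{ -1/3}s([n])$. A rainbow sum in an $r$-coloring $f:A\to[r]$ is a triple of distinct $x,y,z\in A$ with $x+y=z$ and $f(x),f(y),f(z)$ pairwise distinct; $f$ is rainbow sum-free if there is none. For a collection $\mathcal{P}$ of templates, $g(\mathcal{P},A)$ is the number of rainbow sum-free $r$-colorings $f$ of $A$ for which there is some $P\in\mathcal{P}$ with $f(x)\in P(x)$ for all $x\in A$. -}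

module Defs where

open import Data.Nat using (ℕ; zero; suc; _+_; _*_; _∸_; _^_; _≤_; _<_; _<?_)
open import Data.Nat.Properties using () renaming (_≟_ to _≟ℕ_)
open import Data.Bool using (Bool; true; false; if_then_else_; _∧_)
open import Data.Fin using (Fin; toℕ) renaming (_≟_ to _≟F_)
open import Data.Fin.Subset using (Subset; _∈_; _∉_; ∣_∣; ⁅_⁆; _∪_)
open import Data.Fin.Subset.Properties using (_∈?_)
open import Data.List using (List; allFin; map)
open import Data.Nat.ListAction using (sum)
open import Data.Vec using (Vec; lookup)
open import Data.Vec.Properties using (≡-dec)
import Data.Bool.Properties as BoolP
open import Data.Maybe using (Maybe; just; nothing)
open import Data.Product using (Σ; _×_; _,_; ∃-syntax)
open import Relation.Nullary using (¬_; does)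
open import Relation.Binary.PropositionalEquality using (_≡_; _≢_)

-- Element x : Fin n represents the integer  val x = toℕ x + 1  of [n] = {1,…,n}.
-- Colours are Fin r (representing [r]); a palette is a Subset r.
val : ∀ {n} → Fin n → ℕ
val x = suc (toℕ x)

sumFin : ∀ {n} → (Fin n → ℕ) → ℕ
sumFin {n} f = sum (map f (allFin n))

ind : Bool → ℕ
ind b = if b then 1 else 0

-- (a,b,c) is a restricted Schur triple: a < b < c, a + b = c  (c > b is implied)
isSchur : ∀ {n} → Fin n → Fin n → Fin n → Bool
isSchur a b c = does (val a <? val b) ∧ does ((val a + val b) ≟ℕ val c)

s : ℕ → ℕ
s n = sumFin {n} λ a → sumFin λ b → sumFin λ c → ind (isSchur a b c)

Template : ℕ → ℕ → Set
Template r n = Fin n → Subset r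

distinct3 : ∀ {r} → Fin r → Fin r → Fin r → Bool
distinct3 α β γ = Data.Bool.not (does (α ≟F β)) ∧ Data.Bool.not (does (β ≟F γ))
                  ∧ Data.Bool.not (does (α ≟F γ))

RS : ∀ {r n} → Template r n → ℕ
RS {r} {n} P =
  sumFin {n} λ a → sumFin {n} λ b → sumFin {n} λ c →
  sumFin {r} λ α → sumFin {r} λ β → sumFin {r} λ γ →
  ind (isSchur a b c ∧ does (α ∈? P a) ∧ does (β ∈? P b) ∧ does (γ ∈? P c)
       ∧ distinct3 α β γ)

-- good r-template of A:  |P(x)| ≥ 1 on A and RS(P) ≤ n^(-1/3) s([n]),
-- the latter written equivalently (in ℕ) as  RS(P)^3 · n ≤ s([n])^3.
GoodTemplate : ∀ {r n} → Subset n → Template r n → Set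
GoodTemplate {r} {n} A P =
  (∀ x → x ∈ A → 1 ≤ ∣ P x ∣) × (RS P ^ 3 * n ≤ s n ^ 3)

pairCount : ∀ {r n} → Fin r → Fin r → Subset n → Template r n → ℕ
pairCount {r} {n} i j A P =
  sumFin {n} λ x → ind (does (x ∈? A) ∧ does (≡-dec BoolP._≟_ (P x) (⁅ i ⁆ ∪ ⁅ j ⁆)))

-- "at least (1 - 2δ) n elements", δ = 1/(24 log₂ n):
--   n - c ≤ n / (12 log₂ n)  ⇔  12 (n - c) log₂ n ≤ n  ⇔  n^(12 (n - c)) ≤ 2^n.
ManyPairs : ∀ {r n} → Fin r → Fin r → Subset n → Template r n → Set
ManyPairs {r} {n} i j A P = n ^ (12 * (n ∸ pairCount i j A P)) ≤ 2 ^ n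

InCalP : ∀ {r n} → Fin r → Fin r → Subset n → Template r n → Set
InCalP i j A P = GoodTemplate A P × ManyPairs i j A P

-- An r-colouring of A ⊆ [n] is encoded canonically as a vector f with
-- f[x] = just (colour) for x ∈ A and f[x] = nothing for x ∉ A.
Colouring : ℕ → ℕ → Set
Colouring r n = Vec (Maybe (Fin r)) n

IsColouringOf : ∀ {r n} → Subset n → Colouring r n → Set
IsColouringOf {r} {n} A f =
  (∀ x → x ∈ A → ∃[ α ] lookup f x ≡ just α) × (∀ x → x ∉ A → lookup f x ≡ nothing)

RainbowSumFree : ∀ {r n} → Colouring r n → Set
RainbowSumFree {r} {n} f =
  ∀ (x y z : Fin n) (α β γ : Fin r) →
  x ≢ y → y ≢ z → x ≢ z → val x + val y ≡ val z →
  lookup f x ≡ just α → lookup f y ≡ just β → lookup f z ≡ just γ →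
  ¬ (α ≢ β × β ≢ γ × α ≢ γ)

Compatible : ∀ {r n} → Colouring r n → Template r n → Set
Compatible {r} {n} f P = ∀ (x : Fin n) (α : Fin r) → lookup f x ≡ just α → α ∈ P x

CountedByG : ∀ {r n} → Fin r → Fin r → Subset n → Colouring r n → Set
CountedByG {r} {n} i j A f =
  IsColouringOf A f × RainbowSumFree f × Σ (Template r n) (λ P → InCalP i j A P × Compatible f P)

module Submission where

-- Sort the counted colourings f by the first element ξ of A whose colour lies outside {i, j}.
-- If there is none, f is one of the 2^|A| colourings of A by i and j.  Otherwise the Schur
-- triples through ξ propagate colours: an x < ξ whose partner ξ − x is a smaller element of A
-- must repeat the partner's colour (both lie in {i, j} while f(ξ) does not), and an x > ξ must
-- repeat the colour of x − ξ ∈ A unless that colour is itself outside {i, j}.  Hence f is fixed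
-- by at most (n + 4 |[n] ∖ A|)/2 binary choices and at most 2M unrestricted ones, where M bounds
-- the number of elements coloured outside {i, j}: their palettes differ from {i, j}, and a
-- template of 𝒫(i, j) has few such elements.  The choices are counted by reading f as a word
-- through an automaton that tracks the remaining budget of unrestricted choices.  Summing over ξ,
-- the excess over 2^|A| is at most n · 2^((n + 4 |[n] ∖ A|)/2) · (1 + rn)^(2M), which is small
-- because |[n] ∖ A| ≤ n/27, n^(12M) ≤ 2^n and n^18 ≤ 2^n.

open import Defs
open import Data.Nat
open import Data.Nat.Properties
open import Data.Nat.ListAction using (sum)
open import Data.Nat.ListAction.Properties using (sum-++)
open import Data.Nat.DivMod using (_/_; m/n*n≤m; m*n/n≡m; /-monoˡ-≤)
open import Data.Nat.Solver using (module +-*-Solver)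
open import Data.Bool using (Bool; true; false; if_then_else_; not; _∧_; _∨_)
import Data.Bool.Properties as Bool
open import Data.Fin as Fin using (Fin; toℕ; fromℕ<)
open import Data.Fin.Properties using (toℕ-fromℕ<)
open import Data.Fin.Subset using (Subset; ∣_∣; ⁅_⁆; _∪_) renaming (_∈_ to _∈ₛ_; _∉_ to _∉ₛ_)
open import Data.Fin.Subset.Properties using (x∈p∪q⁻; x∈⁅y⁆⇒x≡y) renaming (_∈?_ to _∈ₛ?_)
open import Data.Vec.Properties using (lookup⇒[]=; []=⇒lookup) renaming (≡-dec to ≡-decᵥ)
open import Data.Maybe using (Maybe; just; nothing)
import Data.Maybe.Properties as Maybe
open import Data.List using (List; []; _∷_; length; map; filter; _++_; allFin; upTo)
open import Data.List.Properties using (length-map; length-filter; length-tabulate; map-tabulate; map-∘; map-++; length-upTo)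
open import Data.List.Relation.Unary.All as All using (All; []; _∷_)
import Data.List.Relation.Unary.All.Properties as Allₚ
open import Data.List.Relation.Unary.Any as Any using (here; there)
open import Data.List.Relation.Unary.Unique.Propositional using (Unique)
open import Data.List.Relation.Unary.AllPairs using ([]; _∷_)
import Data.List.Relation.Unary.Unique.Propositional.Properties as Uniqueₚ
open import Data.List.Membership.Propositional using (_∈_; _∉_)
open import Data.List.Membership.Propositional.Properties
  using (∈-filter⁻; ∈-filter⁺; ∈-map⁺; ∈-allFin; ∈-++⁺ˡ; ∈-++⁺ʳ; ∈-upTo⁺; ∈-upTo⁻)
open import Data.Vec as Vec using (Vec; []; _∷_)
open import Data.Product using (Σ; _×_; _,_; proj₁; proj₂)
open import Data.Sum using (_⊎_; inj₁; inj₂)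
open import Data.Unit using (⊤; tt)
open import Relation.Nullary using (¬_; Dec; yes; no; does; ¬?; contradiction)
open import Relation.Nullary.Decidable using (dec-true; dec-false)
open import Relation.Nullary.Reflects using (ofʸ; ofⁿ)
open import Relation.Binary.Definitions using (DecidableEquality)
open import Relation.Unary using (Decidable)
open import Function using (id; _∘_)
open import Relation.Binary.PropositionalEquality

open +-*-Solver

sumFrom : (ℕ → ℕ) → ℕ → ℕ → ℕ
sumFrom h k zero    = 0
sumFrom h k (suc ℓ) = h k + sumFrom h (suc k) ℓ

module _ (h : ℕ → ℕ) where

  sumFrom-++ : ∀ k ℓ₁ ℓ₂ → sumFrom h k (ℓ₁ + ℓ₂) ≡ sumFrom h k ℓ₁ + sumFrom h (k + ℓ₁) ℓ₂
  sumFrom-++ k zero    ℓ₂ rewrite +-identityʳ k = refl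
  sumFrom-++ k (suc ℓ₁) ℓ₂ rewrite sumFrom-++ (suc k) ℓ₁ ℓ₂ | +-suc k ℓ₁ =
    sym (+-assoc (h k) _ _)

  sumFrom-snoc : ∀ k ℓ → sumFrom h k (suc ℓ) ≡ sumFrom h k ℓ + h (k + ℓ)
  sumFrom-snoc k ℓ = begin
    sumFrom h k (suc ℓ)                  ≡⟨ cong (sumFrom h k) (+-comm 1 ℓ) ⟩
    sumFrom h k (ℓ + 1)                  ≡⟨ sumFrom-++ k ℓ 1 ⟩
    sumFrom h k ℓ + (h (k + ℓ) + 0)      ≡⟨ cong (sumFrom h k ℓ +_) (+-identityʳ _) ⟩
    sumFrom h k ℓ + h (k + ℓ)            ∎
    where open ≡-Reasoning

  sumFrom-monoʳ-≤ : ∀ k {ℓ₁ ℓ₂} → ℓ₁ ≤ ℓ₂ → sumFrom h k ℓ₁ ≤ sumFrom h k ℓ₂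
  sumFrom-monoʳ-≤ k {ℓ₁} ℓ₁≤ℓ₂ with m≤n⇒∃[o]m+o≡n ℓ₁≤ℓ₂
  ... | o , refl rewrite sumFrom-++ k ℓ₁ o = m≤m+n _ _

  sumFrom-suc : ∀ k ℓ → sumFrom (h ∘ suc) k ℓ ≡ sumFrom h (suc k) ℓ
  sumFrom-suc k zero    = refl
  sumFrom-suc k (suc ℓ) = cong (h (suc k) +_) (sumFrom-suc (suc k) ℓ)

  sumFrom≤length : (∀ u → h u ≤ 1) → ∀ k ℓ → sumFrom h k ℓ ≤ ℓ
  sumFrom≤length h≤1 k zero    = z≤n
  sumFrom≤length h≤1 k (suc ℓ) = +-mono-≤ (h≤1 k) (sumFrom≤length h≤1 (suc k) ℓ)

sumFrom-cong : ∀ {g h} k ℓ → (∀ u → k ≤ u → u < k + ℓ → g u ≡ h u) → sumFrom g k ℓ ≡ sumFrom h k ℓ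
sumFrom-cong k zero    eq = refl
sumFrom-cong k (suc ℓ) eq =
  cong₂ _+_ (eq k ≤-refl (m<m+n k z<s))
    (sumFrom-cong (suc k) ℓ λ u k<u u< → eq u (<⇒≤ k<u) (subst (u <_) (sym (+-suc k ℓ)) u<))

sumFrom-mono-≤ : ∀ {g h} k ℓ → (∀ u → g u ≤ h u) → sumFrom g k ℓ ≤ sumFrom h k ℓ
sumFrom-mono-≤ k zero    g≤h = z≤n
sumFrom-mono-≤ k (suc ℓ) g≤h = +-mono-≤ (g≤h k) (sumFrom-mono-≤ (suc k) ℓ g≤h)

sumFrom-distrib-+ : ∀ g h k ℓ → sumFrom (λ u → g u + h u) k ℓ ≡ sumFrom g k ℓ + sumFrom h k ℓ
sumFrom-distrib-+ g h k zero    = refl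
sumFrom-distrib-+ g h k (suc ℓ) rewrite sumFrom-distrib-+ g h (suc k) ℓ =
  solve 4 (λ a b c d → (a :+ b) :+ (c :+ d) := (a :+ c) :+ (b :+ d)) refl
    (g k) (h k) (sumFrom g (suc k) ℓ) (sumFrom h (suc k) ℓ)

sumFrom-zero : ∀ {h} k ℓ → (∀ u → k ≤ u → u < k + ℓ → h u ≡ 0) → sumFrom h k ℓ ≡ 0
sumFrom-zero k zero    eq = refl
sumFrom-zero k (suc ℓ) eq rewrite eq k ≤-refl (m<m+n k z<s) =
  sumFrom-zero (suc k) ℓ λ u k<u u< → eq u (<⇒≤ k<u) (subst (u <_) (sym (+-suc k ℓ)) u<)

sumFrom-const-1 : ∀ k ℓ → sumFrom (λ _ → 1) k ℓ ≡ ℓ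
sumFrom-const-1 k zero    = refl
sumFrom-const-1 k (suc ℓ) = cong suc (sumFrom-const-1 (suc k) ℓ)

sumFrom-reverse : ∀ h c → sumFrom (λ u → h (c ∸ suc u)) 0 c ≡ sumFrom h 0 c
sumFrom-reverse h zero    = refl
sumFrom-reverse h (suc c) = begin
  h c + sumFrom (λ u → h (suc c ∸ suc u)) 1 c
    ≡⟨ cong (h c +_) (sumFrom-suc (λ u → h (suc c ∸ suc u)) 0 c) ⟨
  h c + sumFrom (λ u → h (c ∸ suc u)) 0 c
    ≡⟨ cong (h c +_) (sumFrom-reverse h c) ⟩
  h c + sumFrom h 0 c
    ≡⟨ +-comm (h c) _ ⟩
  sumFrom h 0 c + h c
    ≡⟨ sumFrom-snoc h 0 c ⟨
  sumFrom h 0 (suc c) ∎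
  where open ≡-Reasoning

if-<ᵇ-true : ∀ {m n} (t : ℕ) → m < n → (if m <ᵇ n then t else 0) ≡ t
if-<ᵇ-true {m} {n} t m<n with m <ᵇ n | <ᵇ-reflects-< m n
... | true  | _        = refl
... | false | ofⁿ m≮n = contradiction m<n m≮n

sumFrom-shiftedTail : ∀ h d n →
  sumFrom (λ u → if d <ᵇ u then h (u ∸ suc d) else 0) 0 n ≡ sumFrom h 0 (n ∸ suc d)
sumFrom-shiftedTail h d zero    = refl
sumFrom-shiftedTail h d (suc n)
  rewrite sumFrom-snoc (λ u → if d <ᵇ u then h (u ∸ suc d) else 0) 0 n
        | sumFrom-shiftedTail h d n
  with d <ᵇ n | <ᵇ-reflects-< d n
... | true  | ofʸ d<n rewrite +-∸-assoc 1 d<n = sym (sumFrom-snoc h 0 (n ∸ suc d))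
... | false | ofⁿ d≮n rewrite m≤n⇒m∸n≡0 (≮⇒≥ d≮n) | m≤n⇒m∸n≡0 (m≤n⇒m≤1+n (≮⇒≥ d≮n)) = refl

sumFrom-reflectedHead : ∀ h d m →
  sumFrom (λ u → if u <ᵇ d then h (d ∸ suc u) else 0) 0 (d + m) ≡ sumFrom h 0 d
sumFrom-reflectedHead h d m = begin
  sumFrom g 0 (d + m)                           ≡⟨ sumFrom-++ g 0 d m ⟩
  sumFrom g 0 d + sumFrom g d m                 ≡⟨ cong₂ _+_ (sumFrom-cong 0 d below) (sumFrom-zero d m above) ⟩
  sumFrom (λ u → h (d ∸ suc u)) 0 d + 0         ≡⟨ +-identityʳ _ ⟩
  sumFrom (λ u → h (d ∸ suc u)) 0 d             ≡⟨ sumFrom-reverse h d ⟩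
  sumFrom h 0 d                                 ∎
  where
  open ≡-Reasoning
  g : ℕ → ℕ
  g u = if u <ᵇ d then h (d ∸ suc u) else 0
  below : ∀ u → 0 ≤ u → u < d → g u ≡ h (d ∸ suc u)
  below u _ u<d with u <ᵇ d | <ᵇ-reflects-< u d
  ... | true  | _        = refl
  ... | false | ofⁿ u≮d = contradiction u<d u≮d
  above : ∀ u → d ≤ u → u < d + m → g u ≡ 0
  above u d≤u _ with u <ᵇ d | <ᵇ-reflects-< u d
  ... | true  | ofʸ u<d = contradiction d≤u (<⇒≱ u<d)
  ... | false | _        = refl

*-sumFrom≤ : ∀ {h} c m N → (∀ u → h u ≤ 1) → (∀ u → h u ≡ 1 → c * suc u ≤ m) →
  c * sumFrom h 0 N ≤ m
*-sumFrom≤ c m zero    _   _     rewrite *-zeroʳ c = z≤n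
*-sumFrom≤ {h} c m (suc N) h≤1 one⇒≤ rewrite sumFrom-snoc h 0 N with h N in hN | h≤1 N
... | 0 | _ rewrite +-identityʳ (sumFrom h 0 N) = *-sumFrom≤ c m N h≤1 one⇒≤
... | 1 | _ = ≤-trans (*-monoʳ-≤ c sum≤) (one⇒≤ N hN)
  where
  sum≤ : sumFrom h 0 N + 1 ≤ suc N
  sum≤ = subst (_≤ suc N) (+-comm 1 _) (s≤s (sumFrom≤length h h≤1 0 N))
... | 2+ _ | s≤s ()

sumFin-suc : ∀ {n} (g : Fin (suc n) → ℕ) → sumFin g ≡ g Fin.zero + sumFin (g ∘ Fin.suc)
sumFin-suc {n} g = cong (g Fin.zero +_) (cong sum (trans (map-tabulate Fin.suc g) (sym (map-tabulate id (g ∘ Fin.suc)))))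

sumFin-distrib-+ : ∀ {n} (g h : Fin n → ℕ) → sumFin (λ x → g x + h x) ≡ sumFin g + sumFin h
sumFin-distrib-+ {zero}  g h = refl
sumFin-distrib-+ {suc n} g h
  rewrite sumFin-suc (λ x → g x + h x) | sumFin-suc g | sumFin-suc h
        | sumFin-distrib-+ (g ∘ Fin.suc) (h ∘ Fin.suc) =
  solve 4 (λ a b c d → (a :+ b) :+ (c :+ d) := (a :+ c) :+ (b :+ d)) refl
    (g Fin.zero) (h Fin.zero) (sumFin (g ∘ Fin.suc)) (sumFin (h ∘ Fin.suc))

sumFin-≤ : ∀ {n} (g : Fin n → ℕ) → (∀ x → g x ≤ 1) → sumFin g ≤ n
sumFin-≤ {zero}  g _   = z≤n
sumFin-≤ {suc n} g g≤1 rewrite sumFin-suc g = +-mono-≤ (g≤1 Fin.zero) (sumFin-≤ (g ∘ Fin.suc) (g≤1 ∘ Fin.suc))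

sumFin-toℕ : ∀ n (h : ℕ → ℕ) → sumFin {n} (h ∘ toℕ) ≡ sumFrom h 0 n
sumFin-toℕ zero    h = refl
sumFin-toℕ (suc n) h =
  trans (sumFin-suc {n} (h ∘ toℕ)) (cong (h 0 +_) (trans (sumFin-toℕ n (h ∘ suc)) (sumFrom-suc h 0 n)))

module _ {A : Set} where

  sum-map-mono-≤ : ∀ (g h : A → ℕ) xs → (∀ a → g a ≤ h a) → sum (map g xs) ≤ sum (map h xs)
  sum-map-mono-≤ g h []       _   = z≤n
  sum-map-mono-≤ g h (x ∷ xs) g≤h = +-mono-≤ (g≤h x) (sum-map-mono-≤ g h xs g≤h)

  sum-map-≤ : ∀ (g : A → ℕ) xs c → (∀ a → a ∈ xs → g a ≤ c) → sum (map g xs) ≤ length xs * c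
  sum-map-≤ g []       c _   = z≤n
  sum-map-≤ g (x ∷ xs) c g≤c = +-mono-≤ (g≤c x (here refl)) (sum-map-≤ g xs c (λ a a∈ → g≤c a (there a∈)))

  sum-map-<-at : ∀ (g h : A → ℕ) xs {b} → (∀ a → g a ≤ h a) → b ∈ xs → g b < h b →
    sum (map g xs) < sum (map h xs)
  sum-map-<-at g h (x ∷ xs) g≤h (here refl) gb<hb = +-mono-<-≤ gb<hb (sum-map-mono-≤ g h xs g≤h)
  sum-map-<-at g h (x ∷ xs) g≤h (there b∈)  gb<hb = +-mono-≤-< (g≤h x) (sum-map-<-at g h xs g≤h b∈ gb<hb)

module _ {A K : Set} (_≟_ : DecidableEquality K) (key : A → K) where

  withKey : K → List A → List A
  withKey c = filter (λ a → key a ≟ c)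

  length≤sum-withKey : ∀ cs L → All (λ a → key a ∈ cs) L →
    length L ≤ sum (map (λ c → length (withKey c L)) cs)
  length≤sum-withKey cs []      _            = z≤n
  length≤sum-withKey cs (a ∷ L) (a∈cs ∷ L∈cs) =
    ≤-trans (s≤s (length≤sum-withKey cs L L∈cs))
      (sum-map-<-at (λ c → length (withKey c L)) (λ c → length (withKey c (a ∷ L))) cs grow a∈cs hit)
    where
    grow : ∀ c → length (withKey c L) ≤ length (withKey c (a ∷ L))
    grow c with key a ≟ c
    ... | yes _ = n≤1+n _
    ... | no  _ = ≤-refl
    hit : length (withKey (key a) L) < length (withKey (key a) (a ∷ L))
    hit with key a ≟ key a
    ... | yes _  = ≤-refl
    ... | no  ≢a = contradiction refl ≢a

module _ {X : Set} where

  -- reading past the end gives the default d, so that index arithmetic stays in ℕ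
  lookupℕ : ∀ {ℓ} → X → Vec X ℓ → ℕ → X
  lookupℕ d []      u       = d
  lookupℕ d (a ∷ v) zero    = a
  lookupℕ d (a ∷ v) (suc u) = lookupℕ d v u

  lookupℕ-toℕ : ∀ {n} (d : X) (v : Vec X n) x → lookupℕ d v (toℕ x) ≡ Vec.lookup v x
  lookupℕ-toℕ d (a ∷ v) Fin.zero    = refl
  lookupℕ-toℕ d (a ∷ v) (Fin.suc x) = lookupℕ-toℕ d v x

  lookupℕ-≥ : ∀ {n} (d : X) (v : Vec X n) u → n ≤ u → lookupℕ d v u ≡ d
  lookupℕ-≥ d []      u       _         = refl
  lookupℕ-≥ d (a ∷ v) (suc u) (s≤s n≤u) = lookupℕ-≥ d v u n≤u

  lookupℕ-< : ∀ {n} (d : X) (v : Vec X n) u → lookupℕ d v u ≢ d → u < n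
  lookupℕ-< {n} d v u ≢d with u <? n
  ... | yes u<n = u<n
  ... | no  u≮n = contradiction (lookupℕ-≥ d v u (≮⇒≥ u≮n)) ≢d

  lookup-fromℕ< : ∀ {n} (d : X) (v : Vec X n) u (u<n : u < n) → Vec.lookup v (fromℕ< u<n) ≡ lookupℕ d v u
  lookup-fromℕ< d v u u<n = trans (sym (lookupℕ-toℕ d v (fromℕ< u<n))) (cong (lookupℕ d v) (toℕ-fromℕ< u<n))

  lookupList : X → List X → ℕ → X
  lookupList d []      u       = d
  lookupList d (a ∷ p) zero    = a
  lookupList d (a ∷ p) (suc u) = lookupList d p u

  -- newest first, so that reading one more letter is _∷_
  prefix : (ℕ → X) → ℕ → List X
  prefix F zero    = []
  prefix F (suc k) = F k ∷ prefix F k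

  atIndex : X → List X → ℕ → X
  atIndex d p u = lookupList d p (length p ∸ suc u)

  length-prefix : ∀ F k → length (prefix F k) ≡ k
  length-prefix F zero    = refl
  length-prefix F (suc k) = cong suc (length-prefix F k)

  atIndex-prefix : ∀ d F k u → u < k → atIndex d (prefix F k) u ≡ F u
  atIndex-prefix d F (suc k) u (s≤s u≤k) rewrite length-prefix F k with m≤n⇒m<n∨m≡n u≤k
  ... | inj₂ refl rewrite n∸n≡0 u = refl
  ... | inj₁ u<k rewrite +-∸-assoc 1 u<k =
    trans (cong (lookupList d (prefix F k)) (cong (_∸ suc u) (sym (length-prefix F k))))
          (atIndex-prefix d F k u u<k)

∣∣≡sumFrom : ∀ {n} (A : Subset n) → ∣ A ∣ ≡ sumFrom (ind ∘ lookupℕ false A) 0 n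
∣∣≡sumFrom []          = refl
∣∣≡sumFrom {suc n} (b ∷ A) =
  trans (∣b∷A∣ b) (cong (ind b +_) (trans (∣∣≡sumFrom A) (sumFrom-suc (ind ∘ lookupℕ false (b ∷ A)) 0 n)))
  where
  ∣b∷A∣ : ∀ b → ∣ b ∷ A ∣ ≡ ind b + ∣ A ∣
  ∣b∷A∣ true  = refl
  ∣b∷A∣ false = refl

module _ {P : ℕ → Set} (P? : Decidable P) where

  greatest : ℕ → ℕ
  greatest zero    = 0
  greatest (suc k) = if does (P? (suc k)) then suc k else greatest k

  greatest-satisfies : P 0 → ∀ k → P (greatest k)
  greatest-satisfies P0 zero    = P0
  greatest-satisfies P0 (suc k) with P? (suc k)
  ... | yes Pk = Pk
  ... | no  _  = greatest-satisfies P0 k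

  greatest-maximal : ∀ {m} k → m ≤ k → P m → m ≤ greatest k
  greatest-maximal zero    z≤n _ = z≤n
  greatest-maximal (suc k) m≤k Pm with P? (suc k)
  ... | yes _ = m≤k
  ... | no ¬P with m≤n⇒m<n∨m≡n m≤k
  ...   | inj₁ m<k  = greatest-maximal k (s≤s⁻¹ m<k) Pm
  ...   | inj₂ refl = contradiction Pm ¬P

module _ (h : ℕ → Bool) where

  firstTrue : ℕ → Maybe ℕ
  firstTrue zero    = nothing
  firstTrue (suc n) with firstTrue n
  ... | just x  = just x
  ... | nothing = if h n then just n else nothing

  firstTrue-nothing : ∀ n → firstTrue n ≡ nothing → ∀ u → u < n → h u ≡ false
  firstTrue-nothing (suc n) eq u u<1+n with firstTrue n in eqₙ
  ... | nothing with h n in hn | m≤n⇒m<n∨m≡n (s≤s⁻¹ u<1+n)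
  ...   | false | inj₁ u<n  = firstTrue-nothing n eqₙ u u<n
  ...   | false | inj₂ refl = hn

  firstTrue-just : ∀ n {x} → firstTrue n ≡ just x → x < n × h x ≡ true × (∀ u → u < x → h u ≡ false)
  firstTrue-just (suc n) eq with firstTrue n in eqₙ
  firstTrue-just (suc n) refl | just x with firstTrue-just n eqₙ
  ... | x<n , hx , before = m<n⇒m<1+n x<n , hx , before
  firstTrue-just (suc n) eq | nothing with h n in hn
  firstTrue-just (suc n) refl | nothing | true = ≤-refl , hn , firstTrue-nothing n eqₙ

-- Counting the words accepted by an automaton

module Automaton {X S : Set} (opts : S → List X) (next : S → X → S) where

  Run : ∀ {ℓ} → S → Vec X ℓ → Set
  Run s []      = ⊤
  Run s (a ∷ v) = a ∈ opts s × Run (next s a) v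

  run-of-trajectory : (d : X) (F : ℕ → X) (st : ℕ → S) → ∀ ℓ (v : Vec X ℓ) k →
    (∀ u → u < ℓ → lookupℕ d v u ≡ F (k + u)) →
    (∀ u → k ≤ u → u < k + ℓ → F u ∈ opts (st u) × next (st u) (F u) ≡ st (suc u)) →
    Run (st k) v
  run-of-trajectory d F st zero    []      k _     _    = tt
  run-of-trajectory d F st (suc ℓ) (a ∷ v) k v≡F steps =
    subst (_∈ opts (st k)) (sym a≡) (proj₁ (steps k ≤-refl k<)) ,
    subst (λ t → Run t v) (sym (trans (cong (next (st k)) a≡) (proj₂ (steps k ≤-refl k<))))
      (run-of-trajectory d F st ℓ v (suc k)
        (λ u u<ℓ → trans (v≡F (suc u) (s≤s u<ℓ)) (cong F (+-suc k u)))
        (λ u k<u u< → steps u (<⇒≤ k<u) (subst (u <_) (sym (+-suc k ℓ)) u<)))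
    where
    k< : k < k + suc ℓ
    k< = m<m+n k z<s
    a≡ : a ≡ F k
    a≡ = trans (v≡F 0 z<s) (cong F (+-identityʳ k))

  module Counting (_≟_ : DecidableEquality X) (w : ℕ → S → ℕ)
    (w-step : ∀ ℓ s → sum (map (λ a → w ℓ (next s a)) (opts s)) ≤ w (suc ℓ) s)
    (w-base : ∀ s → 1 ≤ w 0 s) where

    private
      runs-from : ∀ {ℓ} s a (V : List (Vec X (suc ℓ))) → All (λ v → Vec.head v ≡ a) V →
        All (Run s) V → All (Run (next s a)) (map Vec.tail V)
      runs-from s a V heads runs = Allₚ.map⁺ (All.zipWith step (heads , runs))
        where
        step : ∀ {v} → Vec.head v ≡ a × Run s v → Run (next s a) (Vec.tail v)
        step {_ ∷ _} (refl , _ , run) = run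

      reassemble : ∀ {ℓ} a (V : List (Vec X (suc ℓ))) → All (λ v → Vec.head v ≡ a) V →
        map (a ∷_) (map Vec.tail V) ≡ V
      reassemble a []            []            = refl
      reassemble a ((_ ∷ _) ∷ V) (refl ∷ heads) = cong (_ ∷_) (reassemble a V heads)

    runs≤weight : ∀ ℓ s (L : List (Vec X ℓ)) → Unique L → All (Run s) L → length L ≤ w ℓ s
    runs≤weight zero    s []             _                   _ = z≤n
    runs≤weight zero    s ([] ∷ [])      _                   _ = w-base s
    runs≤weight zero    s ([] ∷ [] ∷ L) ((≢[] ∷ _) ∷ _)      _ = contradiction refl ≢[]
    runs≤weight (suc ℓ) s L unique runs = begin
      length L                                                   ≤⟨ length≤sum-withKey _≟_ Vec.head (opts s) L heads∈ ⟩
      sum (map (λ a → length (withKey _≟_ Vec.head a L)) (opts s)) ≤⟨ sum-map-mono-≤ _ _ (opts s) branch ⟩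
      sum (map (λ a → w ℓ (next s a)) (opts s))                  ≤⟨ w-step ℓ s ⟩
      w (suc ℓ) s                                                ∎
      where
      open ≤-Reasoning
      heads∈ : All (λ v → Vec.head v ∈ opts s) L
      heads∈ = All.map (λ { {_ ∷ _} (a∈ , _) → a∈ }) runs
      branch : ∀ a → length (withKey _≟_ Vec.head a L) ≤ w ℓ (next s a)
      branch a = subst (_≤ w ℓ (next s a)) (length-map Vec.tail V)
        (runs≤weight ℓ (next s a) (map Vec.tail V) tails-unique
          (runs-from s a V heads (Allₚ.filter⁺ _ runs)))
        where
        V = withKey _≟_ Vec.head a L
        heads : All (λ v → Vec.head v ≡ a) V
        heads = Allₚ.all-filter _ L
        tails-unique : Unique (map Vec.tail V)
        tails-unique = Uniqueₚ.map⁻ (subst Unique (sym (reassemble a V heads)) (Uniqueₚ.filter⁺ _ unique))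

-- the number of words of length ℓ over one cheap and r expensive letters using at most b expensive ones
budgeted : ℕ → ℕ → ℕ → ℕ
budgeted r zero    b       = 1
budgeted r (suc ℓ) zero    = 1
budgeted r (suc ℓ) (suc b) = budgeted r ℓ (suc b) + r * budgeted r ℓ b

budgeted-zeroʳ : ∀ r ℓ → budgeted r ℓ 0 ≡ 1
budgeted-zeroʳ r zero    = refl
budgeted-zeroʳ r (suc ℓ) = refl

budgeted≤ : ∀ r ℓ b → budgeted r ℓ b ≤ (1 + r * ℓ) ^ b
budgeted≤ r zero    b       rewrite *-zeroʳ r | ^-zeroˡ b = ≤-refl
budgeted≤ r (suc ℓ) zero    = ≤-refl
budgeted≤ r (suc ℓ) (suc b) = begin
  budgeted r ℓ (suc b) + r * budgeted r ℓ b
    ≤⟨ +-mono-≤ (budgeted≤ r ℓ (suc b)) (*-monoʳ-≤ r (budgeted≤ r ℓ b)) ⟩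
  (1 + r * ℓ) * Y + r * Y
    ≡⟨ solve 3 (λ r ℓ Y → (con 1 :+ r :* ℓ) :* Y :+ r :* Y := (con 1 :+ r :* (con 1 :+ ℓ)) :* Y) refl r ℓ Y ⟩
  (1 + r * suc ℓ) * Y
    ≤⟨ *-monoʳ-≤ (1 + r * suc ℓ) (^-monoˡ-≤ b (+-monoʳ-≤ 1 (*-monoʳ-≤ r (n≤1+n ℓ)))) ⟩
  (1 + r * suc ℓ) * (1 + r * suc ℓ) ^ b ∎
  where
  open ≤-Reasoning
  Y = (1 + r * ℓ) ^ b

-- The automata reading colourings

module ColourModel (r : ℕ) (i j : Fin r) (inA : ℕ → Bool) where

  Cell : Set
  Cell = Maybe (Fin r)

  _≟ᶜ_ : DecidableEquality Cell
  _≟ᶜ_ = Maybe.≡-dec Fin._≟_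

  IsPair : Fin r → Set
  IsPair α = α ≡ i ⊎ α ≡ j

  pair≢third : ∀ {α γ} → IsPair α → ¬ IsPair γ → α ≢ γ
  pair≢third pα ¬pγ refl = ¬pγ pα

  pair∈ij : ∀ {α} → IsPair α → just α ∈ just i ∷ just j ∷ []
  pair∈ij (inj₁ refl) = here refl
  pair∈ij (inj₂ refl) = there (here refl)

  isPair : Fin r → Bool
  isPair α = does (α Fin.≟ i) ∨ does (α Fin.≟ j)

  isPair⁺ : ∀ {α} → IsPair α → isPair α ≡ true
  isPair⁺ {α} (inj₁ refl) rewrite dec-true (α Fin.≟ α) refl = refl
  isPair⁺ {α} (inj₂ refl) rewrite dec-true (α Fin.≟ α) refl = Bool.∨-zeroʳ _

  isPair⁻ : ∀ {α} → isPair α ≡ true → IsPair α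
  isPair⁻ {α} eq with α Fin.≟ i | α Fin.≟ j
  ... | yes α≡i | _       = inj₁ α≡i
  ... | no  _   | yes α≡j = inj₂ α≡j

  isThird : Cell → Bool
  isThird nothing  = false
  isThird (just α) = not (isPair α)

  third⇒¬pair : ∀ {γ} → isThird (just γ) ≡ true → ¬ IsPair γ
  third⇒¬pair {γ} third pair rewrite isPair⁺ pair = contradiction third λ ()

  pair⇒¬third : ∀ {α} → IsPair α → isThird (just α) ≡ false
  pair⇒¬third pair rewrite isPair⁺ pair = refl

  third-colour : ∀ c → isThird c ≡ true → Σ (Fin r) λ γ → c ≡ just γ × ¬ IsPair γ
  third-colour (just γ) third = γ , refl , third⇒¬pair third

  ¬third⇒pair : ∀ {α} → isThird (just α) ≡ false → IsPair α
  ¬third⇒pair {α} ¬third = isPair⁻ (Bool.not-injective ¬third)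

  -- the colour a linked cell imposes; if the linked cell is not a pair colour the letter is
  -- paid for as expensive anyway, and i is an arbitrary filler
  forced : Cell → Cell
  forced (just β) = if isPair β then just β else just i
  forced nothing  = just i

  forced-pair : ∀ {β} → IsPair β → forced (just β) ≡ just β
  forced-pair pair rewrite isPair⁺ pair = refl

  allColours : List Cell
  allColours = map just (allFin r)

  length-allColours : length allColours ≡ r
  length-allColours = trans (length-map just (allFin r)) (length-tabulate id)

  module GoodModel where

    opts : ℕ → List Cell
    opts k = if inA k then just i ∷ just j ∷ [] else nothing ∷ []

    next : ℕ → Cell → ℕ
    next k _ = suc k

    weight : ℕ → ℕ → ℕ
    weight ℓ k = 2 ^ sumFrom (λ u → ind (inA u)) k ℓ

    weight-step : ∀ ℓ k → sum (map (λ a → weight ℓ (next k a)) (opts k)) ≤ weight (suc ℓ) k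
    weight-step ℓ k with inA k
    ... | true  = ≤-refl
    ... | false = ≤-reflexive (+-identityʳ _)

    weight-base : ∀ k → 1 ≤ weight 0 k
    weight-base k = ≤-refl

  missing : ℕ → ℕ
  missing u = ind (not (inA u))

  data Kind : Set where
    outside free first : Kind
    linked : ℕ → Kind

  freeBit : Kind → ℕ
  freeBit free = 1
  freeBit _    = 0

  cheap : Kind → List Cell → List Cell
  cheap outside    p = nothing ∷ []
  cheap free       p = just i ∷ just j ∷ []
  cheap first      p = []
  cheap (linked q) p = forced (atIndex nothing p q) ∷ []

  length-cheap : ∀ κ p → length (cheap κ p) ≤ 2 ^ freeBit κ
  length-cheap outside    p = ≤-refl
  length-cheap free       p = ≤-refl
  length-cheap first      p = z≤n
  length-cheap (linked q) p = ≤-refl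

  isCheap? : ∀ κ p (a : Cell) → Dec (a ∈ cheap κ p)
  isCheap? κ p a = Any.any? (a ≟ᶜ_) (cheap κ p)

  expensive : Kind → List Cell → List Cell
  expensive κ p = filter (λ a → ¬? (isCheap? κ p a)) allColours

  length-expensive : ∀ κ p → length (expensive κ p) ≤ r
  length-expensive κ p = subst (length (expensive κ p) ≤_) length-allColours (length-filter _ allColours)

  module BadModel (xi : ℕ) where

    -- index u stands for u + 1 ∈ [n], so u is linked to xi ∸ suc u below xi and to u ∸ suc xi above
    kindInA : ℕ → Kind
    kindInA u =
      if u <ᵇ xi then (if (xi ∸ suc u <ᵇ u) ∧ inA (xi ∸ suc u) then linked (xi ∸ suc u) else free)
      else if xi <ᵇ u then (if inA (u ∸ suc xi) then linked (u ∸ suc xi) else free)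
      else first

    kind : ℕ → Kind
    kind u = if inA u then kindInA u else outside

    -- position, remaining budget of expensive letters, prefix read so far
    State : Set
    State = ℕ × ℕ × List Cell

    optsFor : Kind → List Cell → ℕ → List Cell
    optsFor κ p zero    = cheap κ p
    optsFor κ p (suc b) = cheap κ p ++ expensive κ p

    opts : State → List Cell
    opts (k , b , p) = optsFor (kind k) p b

    next : State → Cell → State
    next (k , b , p) a = suc k , (if does (isCheap? (kind k) p a) then b else pred b) , a ∷ p

    freeCount : ℕ → ℕ → ℕ
    freeCount = sumFrom (freeBit ∘ kind)

    weight : ℕ → State → ℕ
    weight ℓ (k , b , p) = 2 ^ freeCount k ℓ * budgeted r ℓ b

    weight-next-cheap : ∀ ℓ k b p a → a ∈ cheap (kind k) p →
      weight ℓ (next (k , b , p) a) ≡ 2 ^ freeCount (suc k) ℓ * budgeted r ℓ b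
    weight-next-cheap ℓ k b p a a∈ rewrite dec-true (isCheap? (kind k) p a) a∈ = refl

    weight-next-expensive : ∀ ℓ k b p a → a ∈ expensive (kind k) p →
      weight ℓ (next (k , b , p) a) ≡ 2 ^ freeCount (suc k) ℓ * budgeted r ℓ (pred b)
    weight-next-expensive ℓ k b p a a∈
      rewrite dec-false (isCheap? (kind k) p a)
                (proj₂ (∈-filter⁻ (λ a → ¬? (isCheap? (kind k) p a)) {xs = allColours} a∈)) = refl

    weight-suc : ∀ ℓ k b p →
      weight (suc ℓ) (k , b , p) ≡ 2 ^ freeBit (kind k) * 2 ^ freeCount (suc k) ℓ * budgeted r (suc ℓ) b
    weight-suc ℓ k b p = cong (_* budgeted r (suc ℓ) b) (^-distribˡ-+-* 2 (freeBit (kind k)) (freeCount (suc k) ℓ))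

    weight-step : ∀ ℓ s → sum (map (λ a → weight ℓ (next s a)) (opts s)) ≤ weight (suc ℓ) s
    weight-step ℓ (k , zero , p) = begin
      sum (map (λ a → weight ℓ (next (k , 0 , p) a)) (cheap κ p))
        ≤⟨ sum-map-≤ _ (cheap κ p) (P * budgeted r ℓ 0) (λ a a∈ → ≤-reflexive (weight-next-cheap ℓ k 0 p a a∈)) ⟩
      length (cheap κ p) * (P * budgeted r ℓ 0)
        ≤⟨ *-monoˡ-≤ _ (length-cheap κ p) ⟩
      Q * (P * budgeted r ℓ 0)
        ≡⟨ cong (λ t → Q * (P * t)) (trans (budgeted-zeroʳ r ℓ) (sym (budgeted-zeroʳ r (suc ℓ)))) ⟩
      Q * (P * budgeted r (suc ℓ) 0)
        ≡⟨ *-assoc Q P _ ⟨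
      Q * P * budgeted r (suc ℓ) 0
        ≡⟨ weight-suc ℓ k 0 p ⟨
      weight (suc ℓ) (k , 0 , p) ∎
      where
      open ≤-Reasoning
      κ = kind k
      Q = 2 ^ freeBit κ
      P = 2 ^ freeCount (suc k) ℓ
    weight-step ℓ (k , suc b , p) = begin
      sum (map g (cheap κ p ++ expensive κ p))
        ≡⟨ trans (cong sum (map-++ g (cheap κ p) (expensive κ p))) (sum-++ (map g (cheap κ p)) _) ⟩
      sum (map g (cheap κ p)) + sum (map g (expensive κ p))
        ≤⟨ +-mono-≤ (sum-map-≤ g (cheap κ p) (P * G₁) (λ a a∈ → ≤-reflexive (weight-next-cheap ℓ k (suc b) p a a∈)))
                    (sum-map-≤ g (expensive κ p) (P * G₀)
                      (λ a a∈ → ≤-reflexive (weight-next-expensive ℓ k (suc b) p a a∈))) ⟩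
      length (cheap κ p) * (P * G₁) + length (expensive κ p) * (P * G₀)
        ≤⟨ +-mono-≤ (*-monoˡ-≤ _ (length-cheap κ p)) (*-monoˡ-≤ _ (length-expensive κ p)) ⟩
      Q * (P * G₁) + r * (P * G₀)
        ≤⟨ +-monoʳ-≤ (Q * (P * G₁)) (m≤n*m (r * (P * G₀)) Q) ⟩
      Q * (P * G₁) + Q * (r * (P * G₀))
        ≡⟨ solve 5 (λ Q P r G₁ G₀ → Q :* (P :* G₁) :+ Q :* (r :* (P :* G₀)) := Q :* P :* (G₁ :+ r :* G₀))
                   refl Q P r G₁ G₀ ⟩
      Q * P * budgeted r (suc ℓ) (suc b)
        ≡⟨ weight-suc ℓ k (suc b) p ⟨
      weight (suc ℓ) (k , suc b , p) ∎
      where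
      open ≤-Reasoning
      κ = kind k
      g = λ a → weight ℓ (next (k , suc b , p) a)
      Q = 2 ^ freeBit κ
      P = 2 ^ freeCount (suc k) ℓ
      G₁ = budgeted r ℓ (suc b)
      G₀ = budgeted r ℓ b
      instance
        Q≢0 : NonZero Q
        Q≢0 = m^n≢0 2 (freeBit κ)

    weight-base : ∀ s → 1 ≤ weight 0 s
    weight-base (k , b , p) = ≤-refl

    lowerHalf : ℕ → ℕ
    lowerHalf u = if u <ᵇ xi then (if xi ∸ suc u <ᵇ u then 0 else 1) else 0

    freeBit≤ : ∀ u → freeBit (kind u) ≤ lowerHalf u + (if u <ᵇ xi then missing (xi ∸ suc u) else 0)
                                                   + (if xi <ᵇ u then missing (u ∸ suc xi) else 0)
    freeBit≤ u with inA u
    ... | false = z≤n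
    ... | true with u <ᵇ xi
    ...   | true with xi ∸ suc u <ᵇ u | inA (xi ∸ suc u)
    ...     | true  | true  = z≤n
    ...     | true  | false = s≤s z≤n
    ...     | false | _     = s≤s z≤n
    freeBit≤ u | true | false with xi <ᵇ u
    ...     | false = z≤n
    ...     | true with inA (u ∸ suc xi)
    ...       | true  = z≤n
    ...       | false = s≤s z≤n

    lowerHalf-sum : ∀ N → 2 * sumFrom lowerHalf 0 N ≤ suc xi
    lowerHalf-sum N = *-sumFrom≤ 2 (suc xi) N lowerHalf≤1 one⇒
      where
      lowerHalf≤1 : ∀ u → lowerHalf u ≤ 1
      lowerHalf≤1 u with u <ᵇ xi
      ... | false = z≤n
      ... | true with xi ∸ suc u <ᵇ u
      ...   | true  = z≤n
      ...   | false = ≤-refl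
      one⇒ : ∀ u → lowerHalf u ≡ 1 → 2 * suc u ≤ suc xi
      one⇒ u eq with u <ᵇ xi | <ᵇ-reflects-< u xi
      ... | true | ofʸ u<xi with xi ∸ suc u <ᵇ u | <ᵇ-reflects-< (xi ∸ suc u) u
      ...   | false | ofⁿ ≮u = begin
        2 * suc u               ≡⟨ solve 1 (λ u → con 2 :* (con 1 :+ u) := con 1 :+ (u :+ (con 1 :+ u))) refl u ⟩
        suc (u + suc u)         ≤⟨ s≤s (+-monoˡ-≤ (suc u) (≮⇒≥ ≮u)) ⟩
        suc (xi ∸ suc u + suc u) ≡⟨ cong suc (m∸n+n≡m u<xi) ⟩
        suc xi                  ∎
        where open ≤-Reasoning

    freeCount≤ : ∀ n → xi < n → 2 * freeCount 0 n ≤ n + 4 * sumFrom missing 0 n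
    freeCount≤ n xi<n = begin
      2 * freeCount 0 n
        ≤⟨ *-monoʳ-≤ 2 (sumFrom-mono-≤ 0 n freeBit≤) ⟩
      2 * sumFrom (λ u → lowerHalf u + below u + above u) 0 n
        ≡⟨ cong (2 *_) (trans (sumFrom-distrib-+ _ above 0 n)
                              (cong (_+ sumFrom above 0 n) (sumFrom-distrib-+ lowerHalf below 0 n))) ⟩
      2 * (sumFrom lowerHalf 0 n + sumFrom below 0 n + sumFrom above 0 n)
        ≡⟨ *-distribˡ-+ 2 (sumFrom lowerHalf 0 n + sumFrom below 0 n) _ ⟩
      2 * (sumFrom lowerHalf 0 n + sumFrom below 0 n) + 2 * sumFrom above 0 n
        ≡⟨ cong (_+ 2 * sumFrom above 0 n) (*-distribˡ-+ 2 (sumFrom lowerHalf 0 n) _) ⟩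
      2 * sumFrom lowerHalf 0 n + 2 * sumFrom below 0 n + 2 * sumFrom above 0 n
        ≤⟨ +-mono-≤ (+-mono-≤ (lowerHalf-sum n) (*-monoʳ-≤ 2 below≤)) (*-monoʳ-≤ 2 above≤) ⟩
      suc xi + 2 * e + 2 * e
        ≤⟨ +-monoˡ-≤ (2 * e) (+-monoˡ-≤ (2 * e) xi<n) ⟩
      n + 2 * e + 2 * e
        ≡⟨ solve 2 (λ n e → n :+ con 2 :* e :+ con 2 :* e := n :+ con 4 :* e) refl n e ⟩
      n + 4 * e ∎
      where
      open ≤-Reasoning
      e = sumFrom missing 0 n
      below above : ℕ → ℕ
      below u = if u <ᵇ xi then missing (xi ∸ suc u) else 0
      above u = if xi <ᵇ u then missing (u ∸ suc xi) else 0
      below≤ : sumFrom below 0 n ≤ e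
      below≤ with m≤n⇒∃[o]m+o≡n (<⇒≤ xi<n)
      ... | m , refl rewrite sumFrom-reflectedHead missing xi m = sumFrom-monoʳ-≤ missing 0 (m≤m+n xi m)
      above≤ : sumFrom above 0 n ≤ e
      above≤ rewrite sumFrom-shiftedTail missing xi n = sumFrom-monoʳ-≤ missing 0 (m∸n≤m n (suc xi))

    open Automaton opts next using (Run; run-of-trajectory)

    module Trajectory (F : ℕ → Cell)
      (outside⇒nothing : ∀ u → inA u ≡ false → F u ≡ nothing)
      (inside⇒colour : ∀ u → inA u ≡ true → Σ (Fin r) λ α → F u ≡ just α)
      (rainbowFree : ∀ a b c {α β γ} → a ≢ b → b ≢ c → a ≢ c → suc a + suc b ≡ suc c →
                     F a ≡ just α → F b ≡ just β → F c ≡ just γ → ¬ (α ≢ β × β ≢ γ × α ≢ γ))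
      (third-at-xi : isThird (F xi) ≡ true)
      (pair-before-xi : ∀ u → u < xi → isThird (F u) ≡ false) where

      colour-at-xi : Σ (Fin r) λ γ → F xi ≡ just γ × ¬ IsPair γ
      colour-at-xi = third-colour (F xi) third-at-xi

      pair-colour : ∀ u → isThird (F u) ≡ false → inA u ≡ true → Σ (Fin r) λ α → F u ≡ just α × IsPair α
      pair-colour u ¬third u∈A with inside⇒colour u u∈A
      ... | α , Fu≡ = α , Fu≡ , ¬third⇒pair (subst (λ c → isThird c ≡ false) Fu≡ ¬third)

      linked-member : ∀ {q u β} → q < u → F q ≡ just β → IsPair β → F u ≡ just β →
        F u ∈ cheap (linked q) (prefix F u)
      linked-member {q} {u} q<u Fq≡ pair Fu≡ =
        here (trans Fu≡ (sym (trans (cong forced (trans (atIndex-prefix nothing F u q q<u) Fq≡)) (forced-pair pair))))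

      free-member : ∀ {u α} → F u ≡ just α → IsPair α → F u ∈ cheap free (prefix F u)
      free-member Fu≡ pair = subst (_∈ just i ∷ just j ∷ []) (sym Fu≡) (pair∈ij pair)

      agree-below : ∀ {u α β} → u < xi → xi ∸ suc u < u → F (xi ∸ suc u) ≡ just β → IsPair β →
        F u ≡ just α → IsPair α → β ≡ α
      agree-below {u} {α} {β} u<xi p<u Fp≡ pβ Fu≡ pα with β Fin.≟ α
      ... | yes β≡α = β≡α
      ... | no  β≢α with colour-at-xi
      ...   | γ , Fxi≡ , ¬pγ =
        contradiction (β≢α , pair≢third pα ¬pγ , pair≢third pβ ¬pγ)
          (rainbowFree (xi ∸ suc u) u xi (<⇒≢ p<u) (<⇒≢ u<xi) (<⇒≢ (<-trans p<u u<xi))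
            (cong suc (m∸n+n≡m u<xi)) Fp≡ Fu≡ Fxi≡)

      agree-above : ∀ {u α β} → xi < u → F (u ∸ suc xi) ≡ just β → IsPair β →
        F u ≡ just α → IsPair α → β ≡ α
      agree-above {u} {α} {β} xi<u Fq≡ pβ Fu≡ pα with β Fin.≟ α
      ... | yes β≡α = β≡α
      ... | no  β≢α with colour-at-xi
      ...   | γ , Fxi≡ , ¬pγ =
        contradiction (pair≢third pβ ¬pγ , ≢-sym (pair≢third pα ¬pγ) , β≢α)
          (rainbowFree (u ∸ suc xi) xi u q≢xi (<⇒≢ xi<u) (<⇒≢ (∸-monoʳ-< z<s xi<u))
            (cong suc (m∸n+n≡m xi<u)) Fq≡ Fxi≡ Fu≡)
        where
        q≢xi : u ∸ suc xi ≢ xi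
        q≢xi q≡xi = pair≢third pβ ¬pγ (Maybe.just-injective (trans (sym Fq≡) (trans (cong F q≡xi) Fxi≡)))

      linked-below-member : ∀ {u α} → u < xi → xi ∸ suc u < u → inA (xi ∸ suc u) ≡ true →
        F u ≡ just α → IsPair α → F u ∈ cheap (linked (xi ∸ suc u)) (prefix F u)
      linked-below-member u<xi p<u p∈A Fu≡ pα with pair-colour _ (pair-before-xi _ (<-trans p<u u<xi)) p∈A
      ... | β , Fp≡ , pβ = linked-member p<u Fp≡ pβ (trans Fu≡ (cong just (sym (agree-below u<xi p<u Fp≡ pβ Fu≡ pα))))

      linked-above-member : ∀ {u α} → xi < u → inA (u ∸ suc xi) ≡ true → isThird (F (u ∸ suc xi)) ≡ false →
        F u ≡ just α → IsPair α → F u ∈ cheap (linked (u ∸ suc xi)) (prefix F u)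
      linked-above-member xi<u q∈A ¬third Fu≡ pα with pair-colour _ ¬third q∈A
      ... | β , Fq≡ , pβ =
        linked-member (∸-monoʳ-< z<s xi<u) Fq≡ pβ (trans Fu≡ (cong just (sym (agree-above xi<u Fq≡ pβ Fu≡ pα))))

      cheap-correct : ∀ u → isThird (F u) ≡ false → (xi < u → isThird (F (u ∸ suc xi)) ≡ false) →
        F u ∈ cheap (kind u) (prefix F u)
      cheap-correct u ¬third ¬third-above with inA u in u∈A
      ... | false = here (outside⇒nothing u u∈A)
      ... | true with pair-colour u ¬third u∈A
      ...   | α , Fu≡ , pα with u <ᵇ xi | <ᵇ-reflects-< u xi
      ...     | true  | ofʸ u<xi with xi ∸ suc u <ᵇ u | <ᵇ-reflects-< (xi ∸ suc u) u | inA (xi ∸ suc u) in p∈A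
      ...       | true  | ofʸ p<u | true  = linked-below-member u<xi p<u p∈A Fu≡ pα
      ...       | true  | _       | false = free-member Fu≡ pα
      ...       | false | _       | _     = free-member Fu≡ pα
      cheap-correct u ¬third ¬third-above | true | α , Fu≡ , pα | false | ofⁿ u≮xi with xi <ᵇ u | <ᵇ-reflects-< xi u
      ...       | false | ofⁿ xi≮u =
        contradiction (trans (sym third-at-xi)
          (subst (λ v → isThird (F v) ≡ false) (≤-antisym (≮⇒≥ xi≮u) (≮⇒≥ u≮xi)) ¬third)) λ ()
      ...       | true  | ofʸ xi<u with inA (u ∸ suc xi) in q∈A
      ...         | true  = linked-above-member xi<u q∈A (¬third-above xi<u) Fu≡ pα
      ...         | false = free-member Fu≡ pα

      spent : ℕ → ℕ
      spent u = if does (isCheap? (kind u) (prefix F u) (F u)) then 0 else 1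

      thirdBit : ℕ → ℕ
      thirdBit u = ind (isThird (F u))

      spent≤1 : ∀ u → spent u ≤ 1
      spent≤1 u with does (isCheap? (kind u) (prefix F u) (F u))
      ... | true  = z≤n
      ... | false = ≤-refl

      spent-cheap : ∀ u → F u ∈ cheap (kind u) (prefix F u) → spent u ≡ 0
      spent-cheap u ∈cheap rewrite dec-true (isCheap? (kind u) (prefix F u) (F u)) ∈cheap = refl

      spent≤ : ∀ u → spent u ≤ thirdBit u + (if xi <ᵇ u then thirdBit (u ∸ suc xi) else 0)
      spent≤ u with isThird (F u) in third-u
      ... | true = ≤-trans (spent≤1 u) (s≤s z≤n)
      ... | false with xi <? u
      ...   | no xi≮u = ≤-trans (≤-reflexive (spent-cheap u (cheap-correct u third-u λ xi<u → contradiction xi<u xi≮u))) z≤n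
      ...   | yes xi<u with isThird (F (u ∸ suc xi)) in third-q
      ...     | true  = ≤-trans (spent≤1 u) (≤-reflexive (sym (if-<ᵇ-true 1 xi<u)))
      ...     | false = ≤-trans (≤-reflexive (spent-cheap u (cheap-correct u third-u λ _ → third-q))) z≤n

      spent-total : ∀ n → sumFrom spent 0 n ≤ 2 * sumFrom thirdBit 0 n
      spent-total n = begin
        sumFrom spent 0 n                                    ≤⟨ sumFrom-mono-≤ 0 n spent≤ ⟩
        sumFrom (λ u → thirdBit u + above u) 0 n             ≡⟨ sumFrom-distrib-+ thirdBit above 0 n ⟩
        sumFrom thirdBit 0 n + sumFrom above 0 n             ≡⟨ cong (sumFrom thirdBit 0 n +_) (sumFrom-shiftedTail thirdBit xi n) ⟩
        sumFrom thirdBit 0 n + sumFrom thirdBit 0 (n ∸ suc xi)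
          ≤⟨ +-monoʳ-≤ (sumFrom thirdBit 0 n) (sumFrom-monoʳ-≤ thirdBit 0 (m∸n≤m n (suc xi))) ⟩
        sumFrom thirdBit 0 n + sumFrom thirdBit 0 n          ≡⟨ cong (sumFrom thirdBit 0 n +_) (+-identityʳ _) ⟨
        2 * sumFrom thirdBit 0 n                             ∎
        where
        open ≤-Reasoning
        above : ℕ → ℕ
        above u = if xi <ᵇ u then thirdBit (u ∸ suc xi) else 0

      module _ (n B : ℕ) (spent≤B : sumFrom spent 0 n ≤ B) where

        state : ℕ → State
        state u = u , B ∸ sumFrom spent 0 u , prefix F u

        cheap⊆opts : ∀ κ p b {a} → a ∈ cheap κ p → a ∈ optsFor κ p b
        cheap⊆opts κ p zero    a∈ = a∈
        cheap⊆opts κ p (suc b) a∈ = ∈-++⁺ˡ a∈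

        is-colour : ∀ u → F u ∉ cheap (kind u) (prefix F u) → Σ (Fin r) λ α → F u ≡ just α
        is-colour u ∉cheap with inA u in u∈A
        ... | true  = inside⇒colour u u∈A
        ... | false = contradiction (here (outside⇒nothing u u∈A)) ∉cheap

        step : ∀ u → u < n → F u ∈ opts (state u) × next (state u) (F u) ≡ state (suc u)
        step u u<n with isCheap? (kind u) (prefix F u) (F u)
        ... | yes ∈cheap =
          cheap⊆opts (kind u) (prefix F u) (B ∸ sumFrom spent 0 u) ∈cheap , cong (λ b → suc u , b , F u ∷ prefix F u) budget≡
          where
          budget≡ : B ∸ sumFrom spent 0 u ≡ B ∸ sumFrom spent 0 (suc u)
          budget≡ = cong (B ∸_) (sym (trans (sumFrom-snoc spent 0 u)
                      (trans (cong (sumFrom spent 0 u +_) (spent-cheap u ∈cheap)) (+-identityʳ _))))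
        ... | no ∉cheap = member , cong (λ b → suc u , b , F u ∷ prefix F u) budget≡
          where
          c = sumFrom spent 0 u
          c+1≡ : sumFrom spent 0 (suc u) ≡ c + 1
          c+1≡ = trans (sumFrom-snoc spent 0 u) (cong (c +_) (dec-false-spent))
            where
            dec-false-spent : spent u ≡ 1
            dec-false-spent rewrite dec-false (isCheap? (kind u) (prefix F u) (F u)) ∉cheap = refl
          c<B : c < B
          c<B = ≤-trans (≤-reflexive (trans (+-comm 1 c) (sym c+1≡)))
                  (≤-trans (sumFrom-monoʳ-≤ spent 0 u<n) spent≤B)
          budget≡ : pred (B ∸ c) ≡ B ∸ sumFrom spent 0 (suc u)
          budget≡ = trans (pred[m∸n]≡m∸[1+n] B c) (cong (B ∸_) (trans (+-comm 1 c) (sym c+1≡)))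
          expensive-member : F u ∈ expensive (kind u) (prefix F u)
          expensive-member with is-colour u ∉cheap
          ... | α , Fu≡ = ∈-filter⁺ (λ a → ¬? (isCheap? (kind u) (prefix F u) a))
                            (subst (_∈ allColours) (sym Fu≡) (∈-map⁺ just (∈-allFin α))) ∉cheap
          member : F u ∈ optsFor (kind u) (prefix F u) (B ∸ c)
          member with B ∸ c | m<n⇒0<n∸m c<B
          ... | suc _ | _ = ∈-++⁺ʳ (cheap (kind u) (prefix F u)) expensive-member

        run : (v : Vec Cell n) → (∀ u → u < n → lookupℕ nothing v u ≡ F u) → Run (0 , B , []) v
        run v v≡F = run-of-trajectory nothing F state n v 0 v≡F (λ u _ u<n → step u u<n)

≤-half : ∀ {x m} → 2 * x ≤ m → x ≤ m / 2
≤-half {x} {m} 2x≤m = subst (_≤ m / 2) (m*n/n≡m x 2) (/-monoˡ-≤ 2 (subst (_≤ m) (*-comm 2 x) 2x≤m))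

half-double≤ : ∀ m → 2 * (m / 2) ≤ m
half-double≤ m = subst (_≤ m) (*-comm (m / 2) 2) (m/n*n≤m m 2)

^-distribʳ-* : ∀ m n o → (m * n) ^ o ≡ m ^ o * n ^ o
^-distribʳ-* m n zero    = refl
^-distribʳ-* m n (suc o) rewrite ^-distribʳ-* m n o =
  solve 4 (λ m n a b → (m :* n) :* (a :* b) := (m :* a) :* (n :* b)) refl m n (m ^ o) (n ^ o)

^-cancelˡ-≤ : ∀ k {x y} → x ^ suc k ≤ y ^ suc k → x ≤ y
^-cancelˡ-≤ k {x} {y} le with x ≤? y
... | yes x≤y = x≤y
... | no  x≰y = contradiction le (<⇒≱ (^-monoˡ-< (suc k) (≰⇒> x≰y)))

-- the mean value theorem for x ↦ x ^ suc k on [n, n + 1]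
suc-^-≤ : ∀ n k → suc n ^ suc k ≤ n ^ suc k + suc k * suc n ^ k
suc-^-≤ n zero    = ≤-reflexive (solve 1 (λ n → (con 1 :+ n) :^ 1 := n :^ 1 :+ con 1 :* (con 1 :+ n) :^ 0) refl n)
suc-^-≤ n (suc k) = begin
  suc n * suc n ^ suc k
    ≤⟨ *-monoʳ-≤ (suc n) (suc-^-≤ n k) ⟩
  suc n * (n ^ suc k + suc k * suc n ^ k)
    ≡⟨ solve 4 (λ n a k b → (con 1 :+ n) :* (a :+ (con 1 :+ k) :* b)
                           := n :* a :+ (a :+ (con 1 :+ k) :* ((con 1 :+ n) :* b))) refl n (n ^ suc k) k (suc n ^ k) ⟩
  n * n ^ suc k + (n ^ suc k + suc k * (suc n * suc n ^ k))
    ≤⟨ +-monoʳ-≤ (n * n ^ suc k) (+-monoˡ-≤ _ (^-monoˡ-≤ (suc k) (n≤1+n n))) ⟩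
  n ^ suc (suc k) + (suc n ^ suc k + suc k * suc n ^ suc k) ∎
  where open ≤-Reasoning

suc-^≤2*^ : ∀ n k → 2 * suc k ≤ suc n → suc n ^ suc k ≤ 2 * n ^ suc k
suc-^≤2*^ n k 2k+2≤n+1 = *-cancelʳ-≤ Y (2 * Z) (suc n) (+-cancelˡ-≤ (Y * suc n) _ _ (begin
  Y * suc n + Y * suc n
    ≡⟨ solve 2 (λ Y m → Y :* m :+ Y :* m := con 2 :* Y :* m) refl Y (suc n) ⟩
  2 * Y * suc n
    ≤⟨ *-monoˡ-≤ (suc n) (*-monoʳ-≤ 2 (suc-^-≤ n k)) ⟩
  2 * (Z + suc k * W) * suc n
    ≡⟨ solve 4 (λ Z k W m → con 2 :* (Z :+ (con 1 :+ k) :* W) :* m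
                           := con 2 :* Z :* m :+ (con 2 :* (con 1 :+ k)) :* (m :* W)) refl Z k W (suc n) ⟩
  2 * Z * suc n + 2 * suc k * (suc n * W)
    ≤⟨ +-monoʳ-≤ (2 * Z * suc n) (*-monoˡ-≤ _ 2k+2≤n+1) ⟩
  2 * Z * suc n + suc n * (suc n * W)
    ≡⟨ solve 3 (λ A m W → A :+ m :* (m :* W) := (m :* W) :* m :+ A) refl (2 * Z * suc n) (suc n) W ⟩
  Y * suc n + 2 * Z * suc n ∎))
  where
  open ≤-Reasoning
  Y = suc n ^ suc k
  Z = n ^ suc k
  W = suc n ^ k

^18≤2^ : ∀ n → 128 ≤ n → n ^ 18 ≤ 2 ^ n
^18≤2^ n 128≤n = subst (λ m → m ^ 18 ≤ 2 ^ m) (m∸n+n≡m 128≤n) (from128 (n ∸ 128))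
  where
  from128 : ∀ d → (d + 128) ^ 18 ≤ 2 ^ (d + 128)
  from128 zero    = ≤ᵇ⇒≤ (128 ^ 18) (2 ^ 128) tt
  from128 (suc d) = ≤-trans (suc-^≤2*^ (d + 128) 17 (s≤s (≤-trans (≤ᵇ⇒≤ 35 128 tt) (m≤n+m 128 d))))
                            (*-monoʳ-≤ 2 (from128 d))

2^-product : ∀ a b → 2 ^ a * 2 ^ b ≡ 2 ^ (a + b)
2^-product a b = sym (^-distribˡ-+-* 2 a b)

n^12*2^[36e]≤2^[2n] : ∀ n e → 128 ≤ n → 27 * e ≤ n → n ^ 12 * 2 ^ (36 * e) ≤ 2 ^ (2 * n)
n^12*2^[36e]≤2^[2n] n e 128≤n 27e≤n = ^-cancelˡ-≤ 2 (begin
  (n ^ 12 * 2 ^ (36 * e)) ^ 3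
    ≡⟨ ^-distribʳ-* (n ^ 12) (2 ^ (36 * e)) 3 ⟩
  (n ^ 12) ^ 3 * (2 ^ (36 * e)) ^ 3
    ≡⟨ cong₂ _*_ (trans (^-*-assoc n 12 3) (sym (^-*-assoc n 18 2))) (^-*-assoc 2 (36 * e) 3) ⟩
  (n ^ 18) ^ 2 * 2 ^ (36 * e * 3)
    ≤⟨ *-mono-≤ (^-monoˡ-≤ 2 (^18≤2^ n 128≤n)) (^-monoʳ-≤ 2 108e≤4n) ⟩
  (2 ^ n) ^ 2 * 2 ^ (4 * n)
    ≡⟨ cong (_* 2 ^ (4 * n)) (^-*-assoc 2 n 2) ⟩
  2 ^ (n * 2) * 2 ^ (4 * n)
    ≡⟨ 2^-product (n * 2) (4 * n) ⟩
  2 ^ (n * 2 + 4 * n)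
    ≡⟨ cong (2 ^_) (solve 1 (λ n → n :* con 2 :+ con 4 :* n := con 2 :* n :* con 3) refl n) ⟩
  2 ^ (2 * n * 3)
    ≡⟨ ^-*-assoc 2 (2 * n) 3 ⟨
  (2 ^ (2 * n)) ^ 3 ∎)
  where
  open ≤-Reasoning
  108e≤4n : 36 * e * 3 ≤ 4 * n
  108e≤4n = ≤-trans (≤-reflexive (solve 1 (λ e → con 36 :* e :* con 3 := con 4 :* (con 27 :* e)) refl e))
                    (*-monoʳ-≤ 4 27e≤n)

[2^F]^12≤ : ∀ F m → 2 * F ≤ m → (2 ^ F) ^ 12 ≤ 2 ^ (6 * m)
[2^F]^12≤ F m 2F≤m = ≤-trans (≤-reflexive (^-*-assoc 2 F 12))
  (^-monoʳ-≤ 2 (≤-trans (≤-reflexive (solve 1 (λ F → F :* con 12 := con 6 :* (con 2 :* F)) refl F)) (*-monoʳ-≤ 6 2F≤m)))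

[1+rn]^[2M]^12≤ : ∀ r n M → suc r * suc r ≤ n → n ^ (12 * M) ≤ 2 ^ n → ((1 + r * n) ^ (2 * M)) ^ 12 ≤ 2 ^ (3 * n)
[1+rn]^[2M]^12≤ r n M r²≤n nᴹ≤2ⁿ = begin
  ((1 + r * n) ^ (2 * M)) ^ 12
    ≡⟨ ^-*-assoc (1 + r * n) (2 * M) 12 ⟩
  (1 + r * n) ^ (2 * M * 12)
    ≡⟨ cong ((1 + r * n) ^_) (solve 1 (λ M → con 2 :* M :* con 12 := con 2 :* (con 12 :* M)) refl M) ⟩
  (1 + r * n) ^ (2 * (12 * M))
    ≡⟨ ^-*-assoc (1 + r * n) 2 (12 * M) ⟨
  ((1 + r * n) ^ 2) ^ (12 * M)
    ≤⟨ ^-monoˡ-≤ (12 * M) square≤cube ⟩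
  (n ^ 3) ^ (12 * M)
    ≡⟨ trans (^-*-assoc n 3 (12 * M)) (trans (cong (n ^_) (*-comm 3 (12 * M))) (sym (^-*-assoc n (12 * M) 3))) ⟩
  (n ^ (12 * M)) ^ 3
    ≤⟨ ^-monoˡ-≤ 3 nᴹ≤2ⁿ ⟩
  (2 ^ n) ^ 3
    ≡⟨ trans (^-*-assoc 2 n 3) (cong (2 ^_) (*-comm n 3)) ⟩
  2 ^ (3 * n) ∎
  where
  open ≤-Reasoning
  square≤cube : (1 + r * n) ^ 2 ≤ n ^ 3
  square≤cube = begin
    (1 + r * n) ^ 2           ≤⟨ ^-monoˡ-≤ 2 (+-monoˡ-≤ (r * n) (≤-trans (s≤s z≤n) r²≤n)) ⟩
    (n + r * n) ^ 2           ≡⟨ solve 2 (λ n r → (n :+ r :* n) :^ 2 := ((con 1 :+ r) :* (con 1 :+ r)) :* (n :* n)) refl n r ⟩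
    suc r * suc r * (n * n)   ≤⟨ *-monoˡ-≤ (n * n) r²≤n ⟩
    n * (n * n)               ≡⟨ solve 1 (λ n → n :* (n :* n) := n :^ 3) refl n ⟩
    n ^ 3                     ∎

final-bound : ∀ r n e a F M x → 128 + suc r * suc r ≤ n → a + e ≡ n → 27 * e ≤ n →
  2 * F ≤ n + 4 * e → n ^ (12 * M) ≤ 2 ^ n →
  x ≤ n * (2 ^ F * (1 + r * n) ^ (2 * M)) → x ^ 12 * 2 ^ n ≤ 2 ^ (12 * a)
final-bound r n e a F M x n-large a+e≡n 27e≤n 2F≤ nᴹ≤2ⁿ x≤ =
  *-cancelʳ-≤ (x ^ 12 * 2 ^ n) (2 ^ (12 * a)) (2 ^ (12 * e)) {{m^n≢0 2 (12 * e)}} (begin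
  x ^ 12 * 2 ^ n * 2 ^ (12 * e)
    ≤⟨ *-monoˡ-≤ _ (*-monoˡ-≤ _ (^-monoˡ-≤ 12 x≤)) ⟩
  (n * (2 ^ F * Y)) ^ 12 * 2 ^ n * 2 ^ (12 * e)
    ≡⟨ cong (λ t → t * 2 ^ n * 2 ^ (12 * e)) (trans (^-distribʳ-* n _ 12) (cong (n ^ 12 *_) (^-distribʳ-* (2 ^ F) Y 12))) ⟩
  n ^ 12 * ((2 ^ F) ^ 12 * Y ^ 12) * 2 ^ n * 2 ^ (12 * e)
    ≤⟨ *-monoˡ-≤ _ (*-monoˡ-≤ _ (*-monoʳ-≤ (n ^ 12)
         (*-mono-≤ ([2^F]^12≤ F (n + 4 * e) 2F≤) ([1+rn]^[2M]^12≤ r n M (m+n≤o⇒n≤o 128 n-large) nᴹ≤2ⁿ)))) ⟩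
  n ^ 12 * (2 ^ (6 * (n + 4 * e)) * 2 ^ (3 * n)) * 2 ^ n * 2 ^ (12 * e)
    ≡⟨ collect ⟩
  n ^ 12 * 2 ^ (36 * e) * 2 ^ (10 * n)
    ≤⟨ *-monoˡ-≤ _ (n^12*2^[36e]≤2^[2n] n e (m+n≤o⇒m≤o 128 n-large) 27e≤n) ⟩
  2 ^ (2 * n) * 2 ^ (10 * n)
    ≡⟨ 2^-product (2 * n) (10 * n) ⟩
  2 ^ (2 * n + 10 * n)
    ≡⟨ cong (2 ^_) (solve 1 (λ n → con 2 :* n :+ con 10 :* n := con 12 :* n) refl n) ⟩
  2 ^ (12 * n)
    ≡⟨ cong (λ t → 2 ^ (12 * t)) (sym a+e≡n) ⟩
  2 ^ (12 * (a + e))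
    ≡⟨ trans (cong (2 ^_) (*-distribˡ-+ 12 a e)) (sym (2^-product (12 * a) (12 * e))) ⟩
  2 ^ (12 * a) * 2 ^ (12 * e) ∎)
  where
  open ≤-Reasoning
  Y = (1 + r * n) ^ (2 * M)
  collect : n ^ 12 * (2 ^ (6 * (n + 4 * e)) * 2 ^ (3 * n)) * 2 ^ n * 2 ^ (12 * e) ≡ n ^ 12 * 2 ^ (36 * e) * 2 ^ (10 * n)
  collect rewrite 2^-product (6 * (n + 4 * e)) (3 * n) | *-assoc (n ^ 12) (2 ^ (6 * (n + 4 * e) + 3 * n)) (2 ^ n)
                | 2^-product (6 * (n + 4 * e) + 3 * n) n | *-assoc (n ^ 12) (2 ^ (6 * (n + 4 * e) + 3 * n + n)) (2 ^ (12 * e))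
                | 2^-product (6 * (n + 4 * e) + 3 * n + n) (12 * e) | *-assoc (n ^ 12) (2 ^ (36 * e)) (2 ^ (10 * n))
                | 2^-product (36 * e) (10 * n) =
    cong (λ t → n ^ 12 * 2 ^ t)
      (solve 2 (λ n e → con 6 :* (n :+ con 4 :* e) :+ con 3 :* n :+ n :+ con 12 :* e := con 36 :* e :+ con 10 :* n) refl n e)

-- Counting the colourings of A

module CountingColourings (r n : ℕ) (A : Subset n) (i j : Fin r) where

  inA : ℕ → Bool
  inA = lookupℕ false A

  open ColourModel r i j inA

  cell : Colouring r n → ℕ → Cell
  cell = lookupℕ nothing

  outside⇒nothing : ∀ f → IsColouringOf A f → ∀ u → inA u ≡ false → cell f u ≡ nothing
  outside⇒nothing f (_ , off-A) u u∉A with u <? n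
  ... | no  u≮n = lookupℕ-≥ nothing f u (≮⇒≥ u≮n)
  ... | yes u<n = trans (sym (lookup-fromℕ< nothing f u u<n)) (off-A (fromℕ< u<n) x∉A)
    where
    x∉A : fromℕ< u<n ∉ₛ A
    x∉A x∈A = contradiction (trans (sym ([]=⇒lookup x∈A)) (trans (lookup-fromℕ< false A u u<n) u∉A)) λ ()

  inside⇒colour : ∀ f → IsColouringOf A f → ∀ u → inA u ≡ true → Σ (Fin r) λ α → cell f u ≡ just α
  inside⇒colour f (on-A , _) u u∈A =
    let α , fx≡ = on-A x (lookup⇒[]= x A (trans (lookup-fromℕ< false A u u<n) u∈A))
    in α , trans (sym (lookup-fromℕ< nothing f u u<n)) fx≡
    where
    u<n : u < n
    u<n = lookupℕ-< false A u λ eq → contradiction (trans (sym u∈A) eq) λ ()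
    x = fromℕ< u<n

  coloured⇒< : ∀ f {u α} → cell f u ≡ just α → u < n
  coloured⇒< f {u} fu≡ = lookupℕ-< nothing f u λ eq → contradiction (trans (sym fu≡) eq) λ ()

  rainbow-free : ∀ f → RainbowSumFree f → ∀ a b c {α β γ} → a ≢ b → b ≢ c → a ≢ c →
    suc a + suc b ≡ suc c → cell f a ≡ just α → cell f b ≡ just β → cell f c ≡ just γ →
    ¬ (α ≢ β × β ≢ γ × α ≢ γ)
  rainbow-free f rsf a b c a≢b b≢c a≢c sum≡ fa fb fc =
    rsf x y z _ _ _ (a≢b ∘ toℕ-≡ a<n b<n) (b≢c ∘ toℕ-≡ b<n c<n) (a≢c ∘ toℕ-≡ a<n c<n)
      (trans (cong₂ (λ s t → suc s + suc t) (toℕ-fromℕ< a<n) (toℕ-fromℕ< b<n))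
             (trans sum≡ (cong suc (sym (toℕ-fromℕ< c<n)))))
      (trans (lookup-fromℕ< nothing f a a<n) fa)
      (trans (lookup-fromℕ< nothing f b b<n) fb)
      (trans (lookup-fromℕ< nothing f c c<n) fc)
    where
    a<n = coloured⇒< f fa
    b<n = coloured⇒< f fb
    c<n = coloured⇒< f fc
    x = fromℕ< a<n
    y = fromℕ< b<n
    z = fromℕ< c<n
    toℕ-≡ : ∀ {s t} (s<n : s < n) (t<n : t < n) → fromℕ< s<n ≡ fromℕ< t<n → s ≡ t
    toℕ-≡ s<n t<n eq = trans (sym (toℕ-fromℕ< s<n)) (trans (cong toℕ eq) (toℕ-fromℕ< t<n))

  thirdCount : Colouring r n → ℕ
  thirdCount f = sumFrom (λ u → ind (isThird (cell f u))) 0 n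

  thirdCount+pairCount≤n : ∀ {f} (P : Template r n) → Compatible f P → thirdCount f + pairCount i j A P ≤ n
  thirdCount+pairCount≤n {f} P compatible = begin
    thirdCount f + pairCount i j A P
      ≡⟨ cong (_+ pairCount i j A P) (sumFin-toℕ n (λ u → ind (isThird (cell f u)))) ⟨
    sumFin {n} (thirdBit ∘ toℕ) + sumFin pairBit
      ≡⟨ sumFin-distrib-+ (thirdBit ∘ toℕ) pairBit ⟨
    sumFin {n} (λ x → thirdBit (toℕ x) + pairBit x)
      ≤⟨ sumFin-≤ _ exclusive ⟩
    n ∎
    where
    open ≤-Reasoning
    thirdBit : ℕ → ℕ
    thirdBit u = ind (isThird (cell f u))
    pairBit : Fin n → ℕ
    pairBit x = ind (does (x ∈ₛ? A) ∧ does (≡-decᵥ Bool._≟_ (P x) (⁅ i ⁆ ∪ ⁅ j ⁆)))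
    ind≤1 : ∀ b → ind b ≤ 1
    ind≤1 true  = ≤-refl
    ind≤1 false = z≤n
    not-third : ∀ x → P x ≡ ⁅ i ⁆ ∪ ⁅ j ⁆ → isThird (cell f (toℕ x)) ≡ false
    not-third x Px≡ rewrite lookupℕ-toℕ nothing f x with Vec.lookup f x in fx≡
    ... | nothing = refl
    ... | just α with x∈p∪q⁻ ⁅ i ⁆ ⁅ j ⁆ (subst (α ∈ₛ_) Px≡ (compatible x α fx≡))
    ...   | inj₁ α∈ = pair⇒¬third (inj₁ (x∈⁅y⁆⇒x≡y i α∈))
    ...   | inj₂ α∈ = pair⇒¬third (inj₂ (x∈⁅y⁆⇒x≡y j α∈))
    exclusive : ∀ x → thirdBit (toℕ x) + pairBit x ≤ 1
    exclusive x with x ∈ₛ? A | ≡-decᵥ Bool._≟_ (P x) (⁅ i ⁆ ∪ ⁅ j ⁆)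
    ... | no  _ | _       = ≤-trans (≤-reflexive (+-identityʳ _)) (ind≤1 _)
    ... | yes _ | no  _   = ≤-trans (≤-reflexive (+-identityʳ _)) (ind≤1 _)
    ... | yes _ | yes Px≡ rewrite not-third x Px≡ = ≤-refl

  M : ℕ
  M = greatest (λ m → n ^ (12 * m) ≤? 2 ^ n) n

  thirdCount≤M : ∀ f → CountedByG i j A f → thirdCount f ≤ M
  thirdCount≤M f (_ , _ , P , (_ , many-pairs) , compatible) =
    ≤-trans (m+n≤o⇒m≤o∸n (thirdCount f) (thirdCount+pairCount≤n {f} P compatible))
      (greatest-maximal (λ m → n ^ (12 * m) ≤? 2 ^ n) n (m∸n≤m n (pairCount i j A P)) many-pairs)

  firstThird : Colouring r n → Maybe ℕ
  firstThird f = firstTrue (isThird ∘ cell f) n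

  candidates : List (Maybe ℕ)
  candidates = nothing ∷ map just (upTo n)

  firstThird∈candidates : ∀ f → firstThird f ∈ candidates
  firstThird∈candidates f with firstThird f in eq
  ... | nothing = here refl
  ... | just x  = there (∈-map⁺ just (∈-upTo⁺ (proj₁ (firstTrue-just (isThird ∘ cell f) n eq))))

  _≟ᵏ_ : DecidableEquality (Maybe ℕ)
  _≟ᵏ_ = Maybe.≡-dec _≟_

  classOf : Maybe ℕ → List (Colouring r n) → List (Colouring r n)
  classOf = withKey _≟ᵏ_ firstThird

  class-member : ∀ {c f} L → f ∈ classOf c L → f ∈ L × firstThird f ≡ c
  class-member {c} L = ∈-filter⁻ (λ f → firstThird f ≟ᵏ c) {xs = L}

  class-unique : ∀ c L → Unique L → Unique (classOf c L)
  class-unique c L = Uniqueₚ.filter⁺ (λ f → firstThird f ≟ᵏ c)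

  module Good = Automaton GoodModel.opts GoodModel.next

  good-run : ∀ {f} → IsColouringOf A f → firstThird f ≡ nothing → Good.Run 0 f
  good-run {f} colouring none = Good.run-of-trajectory nothing (cell f) id n f 0 (λ _ _ → refl) step
    where
    step : ∀ u → 0 ≤ u → u < n → cell f u ∈ GoodModel.opts u × suc u ≡ suc u
    step u _ u<n with inA u in u∈A
    ... | false = here (outside⇒nothing f colouring u u∈A) , refl
    ... | true with inside⇒colour f colouring u u∈A
    ...   | α , fu≡ = subst (_∈ just i ∷ just j ∷ []) (sym fu≡) (pair∈ij (¬third⇒pair ¬third)) , refl
      where
      ¬third : isThird (just α) ≡ false
      ¬third = subst (λ c → isThird c ≡ false) fu≡ (firstTrue-nothing (isThird ∘ cell f) n none u u<n)

  good≤ : ∀ L → Unique L → All (CountedByG i j A) L → length (classOf nothing L) ≤ 2 ^ ∣ A ∣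
  good≤ L unique counted = subst (λ t → length (classOf nothing L) ≤ 2 ^ t) (sym (∣∣≡sumFrom A))
    (Good.Counting.runs≤weight _≟ᶜ_ GoodModel.weight GoodModel.weight-step GoodModel.weight-base
      n 0 (classOf nothing L) (class-unique nothing L unique) (All.tabulate runs))
    where
    runs : ∀ {f} → f ∈ classOf nothing L → Good.Run 0 f
    runs f∈ = let f∈L , none = class-member L f∈ in good-run (proj₁ (All.lookup counted f∈L)) none

  missingCount : ℕ
  missingCount = sumFrom missing 0 n

  freeBudget : ℕ
  freeBudget = (n + 4 * missingCount) / 2

  perClass : ℕ
  perClass = 2 ^ freeBudget * (1 + r * n) ^ (2 * M)

  bad≤ : ∀ L → Unique L → All (CountedByG i j A) L → ∀ xi → xi < n → length (classOf (just xi) L) ≤ perClass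
  bad≤ L unique counted xi xi<n = begin
    length (classOf (just xi) L)
      ≤⟨ Bad.Counting.runs≤weight _≟ᶜ_ weight weight-step weight-base n (0 , 2 * M , [])
           (classOf (just xi) L) (class-unique (just xi) L unique) (All.tabulate runs) ⟩
    2 ^ freeCount 0 n * budgeted r n (2 * M)
      ≤⟨ *-mono-≤ (^-monoʳ-≤ 2 (≤-half {freeCount 0 n} (freeCount≤ n xi<n))) (budgeted≤ r n (2 * M)) ⟩
    perClass ∎
    where
    open ≤-Reasoning
    open BadModel xi
    module Bad = Automaton opts next
    run : ∀ {f} → CountedByG i j A f → firstThird f ≡ just xi → Bad.Run (0 , 2 * M , []) f
    run {f} counted@(colouring , rsf , _) first≡ =
      T.run n (2 * M) (≤-trans (T.spent-total n) (*-monoʳ-≤ 2 (thirdCount≤M f counted))) f (λ _ _ → refl)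
      where
      found = firstTrue-just (isThird ∘ cell f) n first≡
      module T = Trajectory (cell f) (outside⇒nothing f colouring) (inside⇒colour f colouring)
                   (rainbow-free f rsf) (proj₁ (proj₂ found)) (proj₂ (proj₂ found))
    runs : ∀ {f} → f ∈ classOf (just xi) L → Bad.Run (0 , 2 * M , []) f
    runs f∈ = let f∈L , first≡ = class-member L f∈ in run (All.lookup counted f∈L) first≡

  length≤ : ∀ L → Unique L → All (CountedByG i j A) L → length L ≤ 2 ^ ∣ A ∣ + n * perClass
  length≤ L unique counted = begin
    length L
      ≤⟨ length≤sum-withKey _≟ᵏ_ firstThird candidates L (All.tabulate λ {f} _ → firstThird∈candidates f) ⟩
    length (classOf nothing L) + sum (map (λ c → length (classOf c L)) (map just (upTo n)))
      ≡⟨ cong (λ t → length (classOf nothing L) + sum t) (map-∘ (upTo n)) ⟨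
    length (classOf nothing L) + sum (map (λ x → length (classOf (just x) L)) (upTo n))
      ≤⟨ +-mono-≤ (good≤ L unique counted)
                  (sum-map-≤ _ (upTo n) perClass λ x x∈ → bad≤ L unique counted x (∈-upTo⁻ x∈)) ⟩
    2 ^ ∣ A ∣ + length (upTo n) * perClass
      ≡⟨ cong (λ t → 2 ^ ∣ A ∣ + t * perClass) (length-upTo n) ⟩
    2 ^ ∣ A ∣ + n * perClass ∎
    where open ≤-Reasoning

  ∣A∣+missingCount≡n : ∣ A ∣ + missingCount ≡ n
  ∣A∣+missingCount≡n = begin
    ∣ A ∣ + missingCount
      ≡⟨ cong (_+ missingCount) (∣∣≡sumFrom A) ⟩
    sumFrom (ind ∘ inA) 0 n + missingCount
      ≡⟨ sumFrom-distrib-+ (ind ∘ inA) missing 0 n ⟨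
    sumFrom (λ u → ind (inA u) + ind (not (inA u))) 0 n
      ≡⟨ sumFrom-cong 0 n (λ u _ _ → ind+ind-not (inA u)) ⟩
    sumFrom (λ _ → 1) 0 n
      ≡⟨ sumFrom-const-1 0 n ⟩
    n ∎
    where
    open ≡-Reasoning
    ind+ind-not : ∀ b → ind b + ind (not b) ≡ 1
    ind+ind-not true  = refl
    ind+ind-not false = refl

  excess-bound : 128 + suc r * suc r ≤ n → 27 * (n ∸ ∣ A ∣) ≤ n →
    ∀ L → Unique L → All (CountedByG i j A) L → (length L ∸ 2 ^ ∣ A ∣) ^ 12 * 2 ^ n ≤ 2 ^ (12 * ∣ A ∣)
  excess-bound n-large few-missing L unique counted =
    final-bound r n missingCount ∣ A ∣ freeBudget M (length L ∸ 2 ^ ∣ A ∣) n-large ∣A∣+missingCount≡n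
      (subst (λ e → 27 * e ≤ n) missing≡ few-missing)
      (half-double≤ (n + 4 * missingCount))
      (greatest-satisfies (λ m → n ^ (12 * m) ≤? 2 ^ n) (m^n>0 2 n) n)
      (m≤n+o⇒m∸n≤o (length L) (2 ^ ∣ A ∣) (length≤ L unique counted))
    where
    missing≡ : n ∸ ∣ A ∣ ≡ missingCount
    missing≡ = trans (cong (_∸ ∣ A ∣) (sym ∣A∣+missingCount≡n)) (m+n∸m≡n ∣ A ∣ missingCount)

-- the argument does not use i ≢ j
mainTheorem11 : (r : ℕ) → 3 ≤ r →
    Σ ℕ λ N → (n : ℕ) → N ≤ n →
    (A : Subset n) → r ^ 3 * (n ∸ ∣ A ∣) ≤ n →
    (i j : Fin r) → i ≢ j →
    (L : List (Colouring r n)) → Unique L → All (CountedByG i j A) L →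
    (length L ∸ 2 ^ ∣ A ∣) ^ 12 * 2 ^ n ≤ 2 ^ (12 * ∣ A ∣)
mainTheorem11 r 3≤r = 128 + suc r * suc r , λ n n-large A few-missing i j _ →
  CountingColourings.excess-bound r n A i j n-large
    (≤-trans (*-monoˡ-≤ (n ∸ ∣ A ∣) (^-monoˡ-≤ 3 3≤r)) few-missing)
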